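{- Let $\Delta\in\mathcal{H}_{\geq3}$ be a hypergraph on $[d]$ and let $F$ be a consistent formula on $[d]$. Then there exists a unique hypergraph $\Delta_F$ on the vertex set $[d]/F$ that is minimal among hypergraphs $\Gamma$ on $[d]/F$ satisfying: (1) for every $e\in\Delta$ with $|\overline{e}|\geq3$ there is an edge $e'\in\Gamma$ with $\overline{e}\subseteq e'$; and (2) there is no atom $(c_1\not\sim c_2)$ of $F_{\not\sim}$ together with distinct edges $e_1,e_2\in\Gamma$ such that $\{\overline{c_1}_F,\overline{c_2}_F\}\subseteq e_1\cap e_2$. Moreover, $\Delta_F$ is also the unique hypergraph on $[d]/F$ that is minimal among hypergraphs $\Gamma$ on $[d]/F$ satisfying $\Delta_{F_\sim}\leq\Gamma$ together with condition (2).
   Context: A hypergraph on a finite vertex set $V$ is a collection of subsets of $V$ (edges) with no edge a proper subset of another; for collections $\Delta_1,\Delta_2$ of subsets, $\Delta_1\leq\Delta_2$ means each member of $\Delta_1$ is contained in some member of $\Delta_2$. $\mathcal{H}_{\geq3}$ is the set of hypergraphs all of whose edges have size $\ge 3$. A formula on $[d]$ is a conjunction of atoms $(x\sim y)$ and $(x\not\sim y)$, $x,y\in[d]$; $F=F_\sim\wedge F_{\not\sim}$ where $F_\sim$ (resp. $F_{\not\sim}$) is the conjunction of its $\sim$-atoms (resp. $\not\sim$-atoms). The $\sim$-atoms generate an equivalence relation on $[d]$; $[d]/F$ is its set of classes and $\overline{i}_F$ the class of $i$. $F$ is consistent if no atom $(i\not\sim j)$ of $F$ has $\overline{i}_F=\overline{j}_F$.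 For $e\subseteq[d]$, $\overline{e}=\{\overline{i}_F:i\in e\}$, and $\Delta_{F_\sim}=\{\overline{e}: e\in\Delta,\ |\overline{e}|\geq3\}$. -}

module Defs where

open import Data.Nat using (ℕ; _≤_; _≤?_)
open import Data.Fin using (Fin; _≟_)
open import Data.Fin.Properties using (any?)
open import Data.Fin.Subset using (Subset; _∈_; _⊆_; _∩_; ∣_∣)
open import Data.Fin.Subset.Properties using (_∈?_)
open import Data.Vec using (tabulate)
open import Data.List using (List; map; filter)
open import Data.List.Membership.Propositional renaming (_∈_ to _∈ₗ_)
open import Data.Product using (Σ; ∃; ∃-syntax; _×_; _,_)
open import Relation.Nullary using (¬_; does)
open import Relation.Nullary.Decidable using (_×-dec_)
open import Relation.Binary.PropositionalEquality using (_≡_; _≢_)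
open import Relation.Binary.Construct.Closure.Equivalence using (EqClosure)
open import Function.Definitions using (Surjective)
open import Function.Bundles using (_⇔_)

-- A collection of subsets of Fin n (the vertex set [n]), presented as a list
-- (treated as a set: only membership matters).
Coll : ℕ → Set
Coll n = List (Subset n)

IsHypergraph : ∀ {n} → Coll n → Set
IsHypergraph Γ = ∀ {e e′} → e ∈ₗ Γ → e′ ∈ₗ Γ → e ⊆ e′ → e ≡ e′

_≤H_ : ∀ {n} → Coll n → Coll n → Set
Δ₁ ≤H Δ₂ = ∀ {e} → e ∈ₗ Δ₁ → ∃[ e′ ] (e′ ∈ₗ Δ₂ × e ⊆ e′)

_≈H_ : ∀ {n} → Coll n → Coll n → Set
Δ₁ ≈H Δ₂ = ∀ e → (e ∈ₗ Δ₁) ⇔ (e ∈ₗ Δ₂)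

InH≥3 : ∀ {n} → Coll n → Set
InH≥3 Δ = IsHypergraph Δ × (∀ {e} → e ∈ₗ Δ → 3 ≤ ∣ e ∣)

data Atom (d : ℕ) : Set where
  sim  : Fin d → Fin d → Atom d
  nsim : Fin d → Fin d → Atom d

Formula : ℕ → Set
Formula d = List (Atom d)

SimAtom : ∀ {d} → Formula d → Fin d → Fin d → Set
SimAtom F i j = sim i j ∈ₗ F

Equiv : ∀ {d} → Formula d → Fin d → Fin d → Set
Equiv F = EqClosure (SimAtom F)

Consistent : ∀ {d} → Formula d → Set
Consistent F = ∀ {i j} → nsim i j ∈ₗ F → ¬ Equiv F i j

-- A presentation of the quotient [d]/F as Fin m: π i is the class of i (ī_F).
IsQuotientMap : ∀ {d m} → Formula d → (Fin d → Fin m) → Set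
IsQuotientMap F π = Surjective _≡_ _≡_ π × (∀ i j → (π i ≡ π j) ⇔ Equiv F i j)

image : ∀ {d m} → (Fin d → Fin m) → Subset d → Subset m
image π e = tabulate (λ c → does (any? (λ i → (i ∈? e) ×-dec (π i ≟ c))))

ΔFsim : ∀ {d m} → (Fin d → Fin m) → Coll d → Coll m
ΔFsim π Δ = map (image π) (filter (λ e → 3 ≤? ∣ image π e ∣) Δ)

Cond1 : ∀ {d m} → (Fin d → Fin m) → Coll d → Coll m → Set
Cond1 π Δ Γ = ∀ {e} → e ∈ₗ Δ → 3 ≤ ∣ image π e ∣ → ∃[ e′ ] (e′ ∈ₗ Γ × image π e ⊆ e′)

Cond2 : ∀ {d m} → Formula d → (Fin d → Fin m) → Coll m → Set
Cond2 {d} {m} F π Γ =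
  ¬ (Σ (Fin d) λ c₁ → Σ (Fin d) λ c₂ → Σ (Subset m) λ e₁ → Σ (Subset m) λ e₂ →
       nsim c₁ c₂ ∈ₗ F × e₁ ∈ₗ Γ × e₂ ∈ₗ Γ × e₁ ≢ e₂ ×
       π c₁ ∈ (e₁ ∩ e₂) × π c₂ ∈ (e₁ ∩ e₂))

Minimal : ∀ {m} → (Coll m → Set) → Coll m → Set
Minimal P Γ = IsHypergraph Γ × P Γ ×
  (∀ Γ′ → IsHypergraph Γ′ → P Γ′ → Γ′ ≤H Γ → Γ′ ≈H Γ)

UniqueMinimal : ∀ {m} → (Coll m → Set) → Coll m → Set
UniqueMinimal P Γ = Minimal P Γ × (∀ Γ′ → Minimal P Γ′ → Γ′ ≈H Γ)

{-# OPTIONS --safe #-}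
-- Call two sets colliding if both contain the two classes of one ≁-atom. In any
-- Γ satisfying (2), colliding sets lie in colliding, hence equal, edges of Γ, so
-- they may be replaced by their union without leaving the region below Γ.
-- Merging collisions in Δ_{F∼} until none remain (the list shrinks at each step)
-- gives a collection satisfying (2) below every such Γ; its maximal elements form
-- a least, hence unique minimal, solution. Condition (1) is just Δ_{F∼} ≤ Γ.
module Submission where

open import Defs
open import Data.Nat using (ℕ; _≤_; _<_; _≤?_)
open import Data.Nat.Induction using (<-wellFounded)
open import Data.Nat.Properties using (≤-<-trans)
open import Data.Bool using () renaming (_≟_ to _≟ᵇ_)
open import Data.Vec.Properties using (≡-dec)
open import Data.Fin using (Fin)
open import Data.Fin.Subset using (Subset; _∈_; _⊆_; _⊂_; _∪_; ∣_∣)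
open import Data.Fin.Subset.Properties
  using (_∈?_; _⊂?_; ⊆-refl; ⊆-trans; ⊆-antisym; x∈p∩q⁺; x∈p∩q⁻; p⊆p∪q; q⊆p∪q; x∈p∪q⁻)
open import Data.Fin.Subset.Induction using (⊃-wellFounded)
open import Data.List using (_∷_; length; filter)
open import Data.List.Properties using (filter-notAll)
open import Data.List.Relation.Unary.Any using (Any; here; there; any?)
import Data.List.Relation.Unary.Any as Any
open import Data.List.Membership.Propositional using (find; lose) renaming (_∈_ to _∈ₗ_)
open import Data.List.Membership.Propositional.Properties
  using (∈-filter⁺; ∈-filter⁻; ∈-map⁺; ∈-map⁻)
open import Data.Product using (Σ; _×_; _,_; proj₁; proj₂; map₂; ∃-syntax)
open import Data.Sum using (_⊎_; inj₁; inj₂; [_,_])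
open import Data.Empty using (⊥)
open import Function using (_∘_)
open import Function.Bundles using (_⇔_; mk⇔; Equivalence)
import Function.Properties.Equivalence as ⇔
open import Induction.WellFounded using (Acc; acc)
open import Relation.Binary.Definitions using (DecidableEquality; Decidable)
open import Relation.Nullary using (¬_; Dec; yes; no; ¬?; contradiction)
open import Relation.Nullary.Decidable using (_×-dec_)
open import Relation.Binary.PropositionalEquality using (_≡_; _≢_; refl; sym; subst)

_≟ₛ_ : ∀ {m} → DecidableEquality (Subset m)
_≟ₛ_ = ≡-dec _≟ᵇ_

_≢?_ : ∀ {m} → Decidable {A = Subset m} _≢_
A ≢? B = ¬? (A ≟ₛ B)

⊆∧⊄⇒≡ : ∀ {m} {p q : Subset m} → p ⊆ q → ¬ p ⊂ q → p ≡ q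
⊆∧⊄⇒≡ {p = p} p⊆q p⊄q = ⊆-antisym p⊆q q⊆p
  where
  q⊆p : _ ⊆ p
  q⊆p {x} x∈q with x ∈? p
  ... | yes x∈p = x∈p
  ... | no x∉p = contradiction ((λ {y} → p⊆q {y}) , x , x∈q , x∉p) p⊄q

∪-least : ∀ {m} {p q r : Subset m} → p ⊆ r → q ⊆ r → p ∪ q ⊆ r
∪-least {p = p} {q} p⊆r q⊆r x∈ = [ p⊆r , q⊆r ] (x∈p∪q⁻ p q x∈)


module _ {m : ℕ} where

  ≤H-refl : {Γ : Coll m} → Γ ≤H Γ
  ≤H-refl {e = e} e∈ = e , e∈ , ⊆-refl

  ≤H-trans : {Γ₁ Γ₂ Γ₃ : Coll m} → Γ₁ ≤H Γ₂ → Γ₂ ≤H Γ₃ → Γ₁ ≤H Γ₃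
  ≤H-trans Γ₁≤Γ₂ Γ₂≤Γ₃ e∈ with Γ₁≤Γ₂ e∈
  ... | f , f∈ , e⊆f with Γ₂≤Γ₃ f∈
  ... | g , g∈ , f⊆g = g , g∈ , ⊆-trans e⊆f f⊆g

  sublist⇒≤H : {Γ₁ Γ₂ : Coll m} → (∀ {e} → e ∈ₗ Γ₁ → e ∈ₗ Γ₂) → Γ₁ ≤H Γ₂
  sublist⇒≤H Γ₁⊆Γ₂ {e} e∈ = e , Γ₁⊆Γ₂ e∈ , ⊆-refl

  ≤H-antisym-∈ : {Γ₁ Γ₂ : Coll m} → IsHypergraph Γ₁ → Γ₁ ≤H Γ₂ → Γ₂ ≤H Γ₁ →
                 ∀ {e} → e ∈ₗ Γ₁ → e ∈ₗ Γ₂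
  ≤H-antisym-∈ hyp₁ Γ₁≤Γ₂ Γ₂≤Γ₁ e∈ with Γ₁≤Γ₂ e∈
  ... | f , f∈ , e⊆f with Γ₂≤Γ₁ f∈
  ... | g , g∈ , f⊆g with hyp₁ e∈ g∈ (⊆-trans e⊆f f⊆g)
  ... | refl = subst (_∈ₗ _) (sym (⊆-antisym e⊆f f⊆g)) f∈

  ≤H-antisym : {Γ₁ Γ₂ : Coll m} → IsHypergraph Γ₁ → IsHypergraph Γ₂ →
               Γ₁ ≤H Γ₂ → Γ₂ ≤H Γ₁ → Γ₁ ≈H Γ₂
  ≤H-antisym hyp₁ hyp₂ Γ₁≤Γ₂ Γ₂≤Γ₁ e =
    mk⇔ (≤H-antisym-∈ hyp₁ Γ₁≤Γ₂ Γ₂≤Γ₁) (≤H-antisym-∈ hyp₂ Γ₂≤Γ₁ Γ₁≤Γ₂)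

  least⇒uniqueMinimal : (P : Coll m → Set) {Γ₀ : Coll m} → IsHypergraph Γ₀ → P Γ₀ →
                        (∀ {Γ} → P Γ → Γ₀ ≤H Γ) → UniqueMinimal P Γ₀
  least⇒uniqueMinimal P {Γ₀} hyp₀ PΓ₀ least = (hyp₀ , PΓ₀ , minimal) , unique
    where
    minimal : ∀ Γ → IsHypergraph Γ → P Γ → Γ ≤H Γ₀ → Γ ≈H Γ₀
    minimal Γ hyp PΓ Γ≤Γ₀ = ≤H-antisym hyp hyp₀ Γ≤Γ₀ (least PΓ)

    unique : ∀ Γ → Minimal P Γ → Γ ≈H Γ₀
    unique Γ (hyp , PΓ , minimalΓ) e = ⇔.sym (minimalΓ Γ₀ hyp₀ PΓ₀ (least PΓ) e)


module _ {m : ℕ} where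

  IsMaximalIn : Coll m → Subset m → Set
  IsMaximalIn R e = ¬ Any (e ⊂_) R

  isMaximalIn? : ∀ R e → Dec (IsMaximalIn R e)
  isMaximalIn? R e = ¬? (any? (e ⊂?_) R)

  maxima : Coll m → Coll m
  maxima R = filter (isMaximalIn? R) R

  maxima-sublist : ∀ R {e} → e ∈ₗ maxima R → e ∈ₗ R
  maxima-sublist R e∈ = proj₁ (∈-filter⁻ (isMaximalIn? R) e∈)

  maxima-maximal : ∀ R {e} → e ∈ₗ maxima R → IsMaximalIn R e
  maxima-maximal R e∈ = proj₂ (∈-filter⁻ (isMaximalIn? R) {xs = R} e∈)

  maxima-isHypergraph : ∀ R → IsHypergraph (maxima R)
  maxima-isHypergraph R x∈ y∈ x⊆y =
    ⊆∧⊄⇒≡ x⊆y (λ x⊂y → maxima-maximal R x∈ (lose (maxima-sublist R y∈) x⊂y))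

  ≤H-maxima : ∀ R → R ≤H maxima R
  ≤H-maxima R {e} e∈ = go e∈ (⊃-wellFounded e)
    where
    go : ∀ {e} → e ∈ₗ R → Acc _ e → ∃[ e′ ] (e′ ∈ₗ maxima R × e ⊆ e′)
    go {e} e∈ (acc rec) with any? (e ⊂?_) R
    ... | no e-maximal = e , ∈-filter⁺ (isMaximalIn? R) e∈ e-maximal , ⊆-refl
    ... | yes e⊂some with find e⊂some
    ...   | f , f∈ , e⊂f with go f∈ (rec e⊂f)
    ...     | g , g∈ , f⊆g = g , g∈ , ⊆-trans (proj₁ e⊂f) f⊆g


module Merging {m : ℕ} (_≍_ : Subset m → Subset m → Set) (_≍?_ : Decidable _≍_)
               (≍-mono : ∀ {A A′ B B′} → A ⊆ A′ → B ⊆ B′ → A ≍ B → A′ ≍ B′) where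

  Merged : Coll m → Set
  Merged Γ = ∀ {A B} → A ∈ₗ Γ → B ∈ₗ Γ → A ≍ B → A ≡ B

  merged-sublist : {Γ₁ Γ₂ : Coll m} → (∀ {e} → e ∈ₗ Γ₁ → e ∈ₗ Γ₂) → Merged Γ₂ → Merged Γ₁
  merged-sublist Γ₁⊆Γ₂ merged A∈ B∈ = merged (Γ₁⊆Γ₂ A∈) (Γ₁⊆Γ₂ B∈)

  _without_ : Coll m → Subset m → Coll m
  L without A = filter (_≢? A) L

  without-sublist : ∀ {L A e} → e ∈ₗ L without A → e ∈ₗ L
  without-sublist {A = A} = proj₁ ∘ ∈-filter⁻ (_≢? A)

  ∈-without : ∀ {L A e} → e ∈ₗ L → e ≢ A → e ∈ₗ L without A
  ∈-without {A = A} = ∈-filter⁺ (_≢? A)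

  length-without : ∀ {L A} → A ∈ₗ L → length (L without A) < length L
  length-without {L} {A} A∈ = filter-notAll (_≢? A) L (lose A∈ (λ A≢A → A≢A refl))

  mergeIn : Subset m → Subset m → Coll m → Coll m
  mergeIn A B L = A ∪ B ∷ (L without A) without B

  length-mergeIn : ∀ {L A B} → A ∈ₗ L → B ∈ₗ L → A ≢ B → length (mergeIn A B L) < length L
  length-mergeIn A∈ B∈ A≢B =
    ≤-<-trans (length-without (∈-without B∈ (A≢B ∘ sym))) (length-without A∈)

  ≤H-mergeIn : ∀ {L} A B → L ≤H mergeIn A B L
  ≤H-mergeIn A B {e} e∈ with e ≟ₛ A | e ≟ₛ B
  ... | yes refl | _        = A ∪ B , here refl , p⊆p∪q B
  ... | no _     | yes refl = A ∪ B , here refl , q⊆p∪q A B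
  ... | no e≢A   | no e≢B   = e , there (∈-without (∈-without e∈ e≢A) e≢B) , ⊆-refl

  mergeIn-≤H : ∀ {L A B Γ} → A ∈ₗ L → B ∈ₗ L → A ≍ B → Merged Γ → L ≤H Γ →
               mergeIn A B L ≤H Γ
  mergeIn-≤H A∈ B∈ A≍B merged L≤Γ (here refl) with L≤Γ A∈ | L≤Γ B∈
  ... | g , g∈ , A⊆g | h , h∈ , B⊆h with merged g∈ h∈ (≍-mono A⊆g B⊆h A≍B)
  ... | refl = g , g∈ , ∪-least A⊆g B⊆h
  mergeIn-≤H _ _ _ _ L≤Γ (there e∈) = L≤Γ (without-sublist (without-sublist e∈))

  record IsLeastMergedBound (L Γ₀ : Coll m) : Set where
    field
      bound  : L ≤H Γ₀
      merged : Merged Γ₀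
      least  : ∀ {Γ} → Merged Γ → L ≤H Γ → Γ₀ ≤H Γ

  record Collision (L : Coll m) : Set where
    field
      {A B} : Subset m
      A∈L : A ∈ₗ L
      B∈L : B ∈ₗ L
      A≢B : A ≢ B
      A≍B : A ≍ B

  merged-or-collision : ∀ L → Merged L ⊎ Collision L
  merged-or-collision L with any? (λ A → any? (λ B → (A ≢? B) ×-dec (A ≍? B)) L) L
  ... | no noCollision = inj₁ merged
    where
    merged : Merged L
    merged {A} {B} A∈ B∈ A≍B with A ≟ₛ B
    ... | yes A≡B = A≡B
    ... | no A≢B = contradiction (lose A∈ (lose B∈ (A≢B , A≍B))) noCollision
  ... | yes collides with find collides
  ...   | A , A∈ , collidesA with find collidesA
  ...     | B , B∈ , A≢B , A≍B = inj₂ (record { A∈L = A∈ ; B∈L = B∈ ; A≢B = A≢B ; A≍B = A≍B })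

  resolve : ∀ {L} → Collision L → Coll m
  resolve {L} c = mergeIn A B L
    where open Collision c

  length-resolve : ∀ {L} (c : Collision L) → length (resolve c) < length L
  length-resolve c = length-mergeIn A∈L B∈L A≢B
    where open Collision c

  resolve-isLeastMergedBound : ∀ {L Γ₀} (c : Collision L) →
                               IsLeastMergedBound (resolve c) Γ₀ → IsLeastMergedBound L Γ₀
  resolve-isLeastMergedBound c isLeast = record
    { bound  = ≤H-trans (≤H-mergeIn A B) bound
    ; merged = merged
    ; least  = λ mergedΓ L≤Γ → least mergedΓ (mergeIn-≤H A∈L B∈L A≍B mergedΓ L≤Γ)
    }
    where open Collision c
          open IsLeastMergedBound isLeast

  leastMergedBound : ∀ L → Σ (Coll m) (IsLeastMergedBound L)
  leastMergedBound L = go L (<-wellFounded (length L))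
    where
    go : ∀ L → Acc _<_ (length L) → Σ (Coll m) (IsLeastMergedBound L)
    go L (acc rec) with merged-or-collision L
    ... | inj₁ merged = L , record { bound = ≤H-refl ; merged = merged ; least = λ _ L≤Γ → L≤Γ }
    ... | inj₂ c = map₂ (resolve-isLeastMergedBound c) (go (resolve c) (rec (length-resolve c)))

  leastMergedHypergraph : ∀ L → Σ (Coll m) λ Γ₀ → IsHypergraph Γ₀ × IsLeastMergedBound L Γ₀
  leastMergedHypergraph L with leastMergedBound L
  ... | Γ₀ , isLeast = maxima Γ₀ , maxima-isHypergraph Γ₀ , record
    { bound  = ≤H-trans bound (≤H-maxima Γ₀)
    ; merged = merged-sublist (maxima-sublist Γ₀) merged
    ; least  = λ mergedΓ L≤Γ → ≤H-trans (sublist⇒≤H (maxima-sublist Γ₀)) (least mergedΓ L≤Γ)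
    }
    where open IsLeastMergedBound isLeast


module _ {d m : ℕ} (π : Fin d → Fin m) where

  cond1⇔ΔFsim≤H : ∀ Δ Γ → Cond1 π Δ Γ ⇔ ΔFsim π Δ ≤H Γ
  cond1⇔ΔFsim≤H Δ Γ = mk⇔ to from
    where
    big? : (e : Subset d) → Dec (3 ≤ ∣ image π e ∣)
    big? e = 3 ≤? ∣ image π e ∣

    to : Cond1 π Δ Γ → ΔFsim π Δ ≤H Γ
    to cond1 e∈ with ∈-map⁻ (image π) e∈
    ... | e , e∈big , refl with ∈-filter⁻ big? {xs = Δ} e∈big
    ...   | e∈Δ , big = cond1 e∈Δ big

    from : ΔFsim π Δ ≤H Γ → Cond1 π Δ Γ
    from ΔFsim≤Γ e∈ big = ΔFsim≤Γ (∈-map⁺ (image π) (∈-filter⁺ big? e∈ big))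


module NsimMerging {d m : ℕ} (F : Formula d) (π : Fin d → Fin m) where

  BothClassesIn : Atom d → Subset m → Set
  BothClassesIn (sim _ _)    A = ⊥
  BothClassesIn (nsim c₁ c₂) A = π c₁ ∈ A × π c₂ ∈ A

  bothClassesIn? : ∀ a A → Dec (BothClassesIn a A)
  bothClassesIn? (sim _ _)    A = no λ ()
  bothClassesIn? (nsim c₁ c₂) A = (π c₁ ∈? A) ×-dec (π c₂ ∈? A)

  bothClassesIn-mono : ∀ a {A A′} → A ⊆ A′ → BothClassesIn a A → BothClassesIn a A′
  bothClassesIn-mono (nsim _ _) A⊆A′ (c₁∈ , c₂∈) = A⊆A′ c₁∈ , A⊆A′ c₂∈

  ShareNsim : Subset m → Subset m → Set
  ShareNsim A B = Any (λ a → BothClassesIn a A × BothClassesIn a B) F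

  shareNsim? : Decidable ShareNsim
  shareNsim? A B = any? (λ a → bothClassesIn? a A ×-dec bothClassesIn? a B) F

  shareNsim-mono : ∀ {A A′ B B′} → A ⊆ A′ → B ⊆ B′ → ShareNsim A B → ShareNsim A′ B′
  shareNsim-mono A⊆A′ B⊆B′ =
    Any.map λ {a} (inA , inB) → bothClassesIn-mono a A⊆A′ inA , bothClassesIn-mono a B⊆B′ inB

  open Merging ShareNsim shareNsim? shareNsim-mono public

  cond2⇔merged : ∀ Γ → Cond2 F π Γ ⇔ Merged Γ
  cond2⇔merged Γ = mk⇔ to from
    where
    to : Cond2 F π Γ → Merged Γ
    to cond2 {A} {B} A∈ B∈ share with A ≟ₛ B | find share
    ... | yes A≡B | _ = A≡B
    ... | no A≢B | nsim c₁ c₂ , atom∈ , (c₁∈A , c₂∈A) , (c₁∈B , c₂∈B) =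
      contradiction (c₁ , c₂ , A , B , atom∈ , A∈ , B∈ , A≢B ,
                     x∈p∩q⁺ (c₁∈A , c₁∈B) , x∈p∩q⁺ (c₂∈A , c₂∈B)) cond2

    from : Merged Γ → Cond2 F π Γ
    from merged (c₁ , c₂ , e₁ , e₂ , atom∈ , e₁∈ , e₂∈ , e₁≢e₂ , c₁∈ , c₂∈)
      with x∈p∩q⁻ e₁ e₂ c₁∈ | x∈p∩q⁻ e₁ e₂ c₂∈
    ... | c₁∈e₁ , c₁∈e₂ | c₂∈e₁ , c₂∈e₂ =
      e₁≢e₂ (merged e₁∈ e₂∈ (lose atom∈ ((c₁∈e₁ , c₂∈e₁) , (c₁∈e₂ , c₂∈e₂))))


lemma3p13 : ∀ {d} (Δ : Coll d) → InH≥3 Δ → (F : Formula d) → Consistent F →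
            ∀ {m} (π : Fin d → Fin m) → IsQuotientMap F π →
            Σ (Coll m) λ ΔF →
              UniqueMinimal (λ Γ → Cond1 π Δ Γ × Cond2 F π Γ) ΔF ×
              UniqueMinimal (λ Γ → ΔFsim π Δ ≤H Γ × Cond2 F π Γ) ΔF
lemma3p13 Δ _ F _ π _ with NsimMerging.leastMergedHypergraph F π (ΔFsim π Δ)
... | ΔF , hyp , isLeast =
  ΔF , least⇒uniqueMinimal _ hyp solves₁
         (λ { (cond1 , cond2) → leastΔF (to (cond1⇔ΔFsim≤H π Δ _) cond1) cond2 })
     , least⇒uniqueMinimal _ hyp solves₂
         (λ { (ΔFsim≤Γ , cond2) → leastΔF ΔFsim≤Γ cond2 })
  where
  open NsimMerging F π
  open IsLeastMergedBound isLeast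
  open Equivalence

  solves₂ : ΔFsim π Δ ≤H ΔF × Cond2 F π ΔF
  solves₂ = bound , from (cond2⇔merged ΔF) merged

  solves₁ : Cond1 π Δ ΔF × Cond2 F π ΔF
  solves₁ = from (cond1⇔ΔFsim≤H π Δ ΔF) bound , proj₂ solves₂

  leastΔF : ∀ {Γ} → ΔFsim π Δ ≤H Γ → Cond2 F π Γ → ΔF ≤H Γ
  leastΔF ΔFsim≤Γ cond2 = least (to (cond2⇔merged _) cond2) ΔFsim≤Γ
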